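{- There exist a free abelian group $G$ and a semilinear subset $A\subseteq G$ such that $A$ is not a minimal complement to any subset of $G$ and $A$ has no minimal complement in $G$.
   Context: For non-empty subsets $A,B$ of an abelian group $G$, $A$ is a minimal complement of $B$ if $A+B=G$ and $(A\setminus\{a\})+B\neq G$ for all $a\in A$. An unbounded arithmetic progression in $\mathbb{Z}$ is a set $\{c+nt:n\in\mathbb{Z}_{\ge0}\}$ with $t\ne0$. An unbounded linear set (unbounded generalised arithmetic progression) in $G$ is an infinite set of the form $\{a+n_1b_1+\cdots+n_db_d: n_i\in F_i\}$ with $a,b_i\in G$ and each $F_i\subseteq\mathbb{Z}$ either an unbounded arithmetic progression or finite. A semilinear set is a finite union of unbounded linear sets. -}

module Defs where

open import Data.Nat using (ℕ; zero; suc)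
open import Data.Integer using (ℤ; +_; _+_; _*_)
open import Data.Fin using (Fin; zero; suc)
open import Data.Vec using (Vec; zipWith; map; replicate)
open import Data.List using (List; _∷_)
open import Data.List.Membership.Propositional using (_∈_)
open import Data.List.Relation.Unary.Any using (Any)
open import Data.Product using (Σ; ∃; _×_; _,_)
open import Relation.Nullary using (¬_)
open import Relation.Binary.PropositionalEquality using (_≡_; _≢_)

G : ℕ → Set
G d = Vec ℤ d

_⊕_ : ∀ {d} → G d → G d → G d
_⊕_ = zipWith _+_

0G : ∀ {d} → G d
0G = replicate _ (+ 0)

_•_ : ∀ {d} → ℤ → G d → G d
n • x = map (n *_) x

Subset : Set → Set₁
Subset X = X → Set

NonEmpty : ∀ {X : Set} → Subset X → Set
NonEmpty {X} A = Σ X A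

Covers : ∀ {d} → Subset (G d) → Subset (G d) → Set
Covers {d} A B = ∀ (g : G d) → Σ (G d) λ a → Σ (G d) λ b → A a × B b × (a ⊕ b ≡ g)

IsMinimalComplement : ∀ {d} → Subset (G d) → Subset (G d) → Set
IsMinimalComplement {d} A B =
  NonEmpty A × NonEmpty B × Covers A B ×
  (∀ (a : G d) → A a → ¬ Covers (λ x → A x × x ≢ a) B)

-- Subsets F ⊆ ℤ used in linear sets: an unbounded arithmetic progression
-- {c + n t : n ∈ ℤ≥0} with t ≠ 0, or a finite set (given by a list).
data ℤSetSpec : Set where
  ap     : (c t : ℤ) → t ≢ + 0 → ℤSetSpec
  finite : List ℤ → ℤSetSpec

_∈ᶻ_ : ℤ → ℤSetSpec → Set
x ∈ᶻ ap c t _   = ∃ λ (n : ℕ) → x ≡ c + (+ n) * t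
x ∈ᶻ finite L   = x ∈ L

sumG : ∀ {d} (k : ℕ) → (Fin k → G d) → G d
sumG zero    v = 0G
sumG (suc k) v = v zero ⊕ sumG k (λ i → v (suc i))

-- Data of a (generalised) linear set {a + n₁b₁ + ⋯ + n_k b_k : nᵢ ∈ Fᵢ}
record LinearSpec (d : ℕ) : Set where
  constructor linSpec
  field
    k : ℕ
    base : G d
    gens : Fin k → G d
    coeffs : Fin k → ℤSetSpec

⟦_⟧ : ∀ {d} → LinearSpec d → Subset (G d)
⟦_⟧ {d} (linSpec k a b F) g =
  Σ (Fin k → ℤ) λ n → (∀ i → n i ∈ᶻ F i) × (g ≡ a ⊕ sumG k (λ i → n i • b i))

Infinite : ∀ {X : Set} → Subset X → Set
Infinite {X} A = ¬ (Σ (List X) λ L → ∀ x → A x → x ∈ L)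

UnboundedLinear : ∀ {d} → LinearSpec d → Set
UnboundedLinear L = Infinite ⟦ L ⟧

Semilinear : ∀ {d} → Subset (G d) → Set
Semilinear {d} A =
  Σ (LinearSpec d) λ L₀ → Σ (List (LinearSpec d)) λ Ls →
    (∀ L → L ∈ (L₀ ∷ Ls) → UnboundedLinear L) ×
    (∀ g → (A g → Any (λ L → ⟦ L ⟧ g) (L₀ ∷ Ls)) × (Any (λ L → ⟦ L ⟧ g) (L₀ ∷ Ls) → A g))

-- Take A = ℕ inside ℤ, the semilinear set 0 + ℕ·1.  It is not a minimal
-- complement: ℕ is carried into ℕ ∖ {0} by the shift x ↦ 1 + x, so if ℕ + B = ℤ
-- then already (ℕ ∖ {0}) + B = ℤ.  It has no minimal complement either: every B
-- with B + ℕ = ℤ is unbounded below, and removing one point keeps it unbounded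
-- below, which is all that B + ℕ = ℤ requires.
module Submission where

open import Defs
open import Data.Nat using (ℕ; suc) renaming (_<_ to _<ℕ_)
import Data.Nat.Properties as ℕ
open import Data.Integer using (ℤ; +_; _+_; _*_; -_; _-_; ∣_∣; _≤_; _⊓_; pred)
open import Data.Integer.Properties
  using (+-assoc; +-identityˡ; +-inverseʳ; *-identityʳ; i≤i+j;
         i≤j⇒0≤j-i; 0≤i⇒+∣i∣≡i; i⊓j≤i; i⊓j≤j; ≤-trans; i≤pred[j]⇒i<j; <⇒≢)
open import Data.Integer.Tactic.RingSolver using (solve-∀)
open import Data.Fin using (zero)
open import Data.Vec using ([]; _∷_; [_]; head; map)
open import Data.Vec.Properties using (zipWith-assoc; zipWith-identityˡ; zipWith-inverseʳ)
import Data.List as List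
open import Data.List using ([])
import Data.List.Extrema.Nat as Extrema
open import Data.List.Membership.Propositional.Properties using (∈-map⁺)
import Data.List.Relation.Unary.All as All
open import Data.List.Relation.Unary.Any using (here; there)
open import Data.Product using (Σ; _×_; _,_)
open import Function using (_∘_)
open import Relation.Nullary using (¬_)
open import Relation.Binary.PropositionalEquality
  using (_≡_; _≢_; refl; sym; trans; cong; subst; module ≡-Reasoning)

⊝_ : ∀ {d} → G d → G d
⊝_ = map (-_)

shift-absorbed⇒¬minimal : ∀ {d} {A : Subset (G d)} (t a : G d) → A a →
  (∀ x → A x → A (t ⊕ x) × t ⊕ x ≢ a) →
  ∀ (B : Subset (G d)) → ¬ IsMinimalComplement A B
shift-absorbed⇒¬minimal {A = A} t a Aa shift B (_ , _ , A+B , minimal) =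
  minimal a Aa A∖a+B
  where
  A∖a+B : Covers (λ x → A x × x ≢ a) B
  A∖a+B g with A+B ((⊝ t) ⊕ g)
  ... | x , b , Ax , Bb , x+b≡g-t = t ⊕ x , b , shift x Ax , Bb , (begin
    (t ⊕ x) ⊕ b        ≡⟨ zipWith-assoc +-assoc t x b ⟩
    t ⊕ (x ⊕ b)        ≡⟨ cong (t ⊕_) x+b≡g-t ⟩
    t ⊕ ((⊝ t) ⊕ g)    ≡⟨ zipWith-assoc +-assoc t (⊝ t) g ⟨
    (t ⊕ (⊝ t)) ⊕ g    ≡⟨ cong (_⊕ g) (zipWith-inverseʳ +-inverseʳ t) ⟩
    0G ⊕ g             ≡⟨ zipWith-identityˡ +-identityˡ g ⟩
    g                  ∎)
    where open ≡-Reasoning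

unbounded-norm⇒infinite : ∀ {X : Set} {A : Subset X} (ν : X → ℕ) →
  (∀ n → Σ X λ x → A x × n <ℕ ν x) → Infinite A
unbounded-norm⇒infinite ν unbounded (L , A⊆L) with unbounded (Extrema.max 0 (List.map ν L))
... | x , Ax , max<νx =
  ℕ.<-irrefl refl (ℕ.<-≤-trans max<νx
    (All.lookup (Extrema.xs≤max 0 (List.map ν L)) (∈-map⁺ ν (A⊆L x Ax))))

ℕ¹ : Subset (G 1)
ℕ¹ v = Σ ℕ λ n → v ≡ [ + n ]

ℕ¹-shift-absorbed : ∀ x → ℕ¹ x → ℕ¹ ([ + 1 ] ⊕ x) × [ + 1 ] ⊕ x ≢ [ + 0 ]
ℕ¹-shift-absorbed _ (n , refl) = (suc n , refl) , λ ()

ℕ¹-not-minimal-complement : ∀ (B : Subset (G 1)) → ¬ IsMinimalComplement ℕ¹ B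
ℕ¹-not-minimal-complement = shift-absorbed⇒¬minimal [ + 1 ] [ + 0 ] (0 , refl) ℕ¹-shift-absorbed

UnboundedBelow : Subset (G 1) → Set
UnboundedBelow B = ∀ g → Σ ℤ λ b → B [ b ] × b ≤ g

complement-of-ℕ¹⇒unbounded-below : ∀ {B : Subset (G 1)} → Covers B ℕ¹ → UnboundedBelow B
complement-of-ℕ¹⇒unbounded-below B+ℕ g with B+ℕ [ g ]
... | b ∷ [] , _ , Bb , (m , refl) , b+m≡g = b , Bb , subst (b ≤_) (cong head b+m≡g) (i≤i+j b (+ m))

unbounded-below⇒complement-of-ℕ¹ : ∀ {B : Subset (G 1)} → UnboundedBelow B → Covers B ℕ¹
unbounded-below⇒complement-of-ℕ¹ unbounded (g ∷ []) with unbounded g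
... | b , Bb , b≤g = [ b ] , [ + ∣ g - b ∣ ] , Bb , (∣ g - b ∣ , refl) ,
  cong [_] (trans (cong (λ k → b + k) (0≤i⇒+∣i∣≡i (i≤j⇒0≤j-i b≤g))) (b+[g-b]≡g b g))
  where
  b+[g-b]≡g : ∀ b g → b + (g - b) ≡ g
  b+[g-b]≡g = solve-∀

unbounded-below-minus-point : ∀ {B : Subset (G 1)} → UnboundedBelow B →
  ∀ c → UnboundedBelow (λ x → B x × x ≢ [ c ])
unbounded-below-minus-point unbounded c g with unbounded (g ⊓ pred c)
... | b , Bb , b≤g⊓c-1 = b , (Bb , b≢c ∘ cong head) , ≤-trans b≤g⊓c-1 (i⊓j≤i g (pred c))
  where
  b≢c : b ≢ c
  b≢c = <⇒≢ (i≤pred[j]⇒i<j (≤-trans b≤g⊓c-1 (i⊓j≤j g (pred c))))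

ℕ¹-has-no-minimal-complement : ∀ (B : Subset (G 1)) → ¬ IsMinimalComplement B ℕ¹
ℕ¹-has-no-minimal-complement B ((c ∷ [] , Bc) , _ , B+ℕ , minimal) =
  minimal [ c ] Bc (unbounded-below⇒complement-of-ℕ¹
    (unbounded-below-minus-point {B} (complement-of-ℕ¹⇒unbounded-below B+ℕ) c))

ray : LinearSpec 1
ray = linSpec 1 [ + 0 ] (λ _ → [ + 1 ]) (λ _ → ap (+ 0) (+ 1) (λ ()))

-- The coordinate of [ 0 ] ⊕ sumG 1 (λ _ → x • [ 1 ]) as it unfolds.
ray-point : ∀ x → + 0 + (x * + 1 + + 0) ≡ x
ray-point = solve-∀

ℕ-as-progression : ∀ m → + 0 + + m * + 1 ≡ + m
ℕ-as-progression m = trans (+-identityˡ _) (*-identityʳ (+ m))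

ℕ¹⊆⟦ray⟧ : ∀ g → ℕ¹ g → ⟦ ray ⟧ g
ℕ¹⊆⟦ray⟧ _ (m , refl) =
  (λ _ → + m) , (λ _ → m , sym (ℕ-as-progression m)) , cong [_] (sym (ray-point (+ m)))

⟦ray⟧⊆ℕ¹ : ∀ g → ⟦ ray ⟧ g → ℕ¹ g
⟦ray⟧⊆ℕ¹ _ (n , n∈ℕ , refl) with n∈ℕ zero
... | m , n≡m = m , cong [_] (trans (ray-point (n zero)) (trans n≡m (ℕ-as-progression m)))

ray-unbounded : UnboundedLinear ray
ray-unbounded = unbounded-norm⇒infinite (∣_∣ ∘ head)
  (λ n → [ + suc n ] , ℕ¹⊆⟦ray⟧ _ (suc n , refl) , ℕ.n<1+n n)

ℕ¹-semilinear : Semilinear ℕ¹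
ℕ¹-semilinear = ray , [] , (λ { _ (here refl) → ray-unbounded ; _ (there ()) }) ,
  λ g → here ∘ ℕ¹⊆⟦ray⟧ g , λ { (here g∈ray) → ⟦ray⟧⊆ℕ¹ g g∈ray ; (there ()) }

corollary5p4 : Σ ℕ λ d → Σ (Subset (G d)) λ A →
    Semilinear A ×
    (∀ (B : Subset (G d)) → ¬ IsMinimalComplement A B) ×
    (∀ (B : Subset (G d)) → ¬ IsMinimalComplement B A)
corollary5p4 = 1 , ℕ¹ , ℕ¹-semilinear , ℕ¹-not-minimal-complement , ℕ¹-has-no-minimal-complement
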